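{- Let $L$ be either of the sequent calculi $\mathrm{lTS4}$ or $\mathrm{gTS4}$ defined in the context. Then $L$ and $\mathrm{GS4}$ are theorem-equivalent, i.e. a sequent is provable in $L$ if and only if it is provable in $\mathrm{GS4}$.
   Context: Formulas are built from countably many propositional variables using the binary connectives $\wedge,\vee,\to$ and the unary connectives $\neg,\Box,\Diamond$. Letters $\Gamma,\Delta$ (possibly with subscripts) denote finite, possibly empty, sets of formulas; a sequent is an expression $\Gamma\Rightarrow\Delta$; a comma denotes union. For a word $w$ over $\{\neg,\Box,\Diamond\}$, $w\Gamma=\{w\gamma:\gamma\in\Gamma\}$. A rule "$S_1;\dots;S_n\,/\,S$" has premises $S_1,\dots,S_n$ and conclusion $S$. Provability includes the rule (cut) unless stated otherwise. The calculus lTS4. Initial sequents: for every propositional variable $p$: $p\Rightarrow p$, $\neg p\Rightarrow\neg p$, $\neg p,p\Rightarrow$, and $\Rightarrow\neg p,p$. Structural rules: (cut) $\Gamma\Rightarrow\alpha$; $\alpha,\Gamma\Rightarrow\Delta$ / $\Gamma\Rightarrow\Delta$. (we-left) $\Gamma\Rightarrow\Delta$ / $\alpha,\Gamma\Rightarrow\Delta$. (we-right) $\Gamma\Rightarrow\Delta$ / $\Gamma\Rightarrow\Delta,\alpha$. Non-twist logical rules: ($\wedge$left) $\alpha,\beta,\Gamma\Rightarrow\Delta$ / $\alpha\wedge\beta,\Gamma\Rightarrow\Delta$. ($\wedge$right) $\Gamma\Rightarrow\Delta,\alpha$; $\Gamma\Rightarrow\Delta,\beta$ / $\Gamma\Rightarrow\Delta,\alpha\wedge\beta$.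 ($\vee$left) $\alpha,\Gamma\Rightarrow\Delta$; $\beta,\Gamma\Rightarrow\Delta$ / $\alpha\vee\beta,\Gamma\Rightarrow\Delta$. ($\vee$right) $\Gamma\Rightarrow\Delta,\alpha,\beta$ / $\Gamma\Rightarrow\Delta,\alpha\vee\beta$. ($\to$left) $\Gamma\Rightarrow\Delta,\alpha$; $\beta,\Gamma\Rightarrow\Delta$ / $\alpha\to\beta,\Gamma\Rightarrow\Delta$. ($\to$right) $\alpha,\Gamma\Rightarrow\Delta,\beta$ / $\Gamma\Rightarrow\Delta,\alpha\to\beta$. ($\Box$left) $\alpha,\Gamma\Rightarrow\Delta$ / $\Box\alpha,\Gamma\Rightarrow\Delta$. ($\Box$right) $\Box\Gamma_1,\neg\Diamond\Gamma_2\Rightarrow\Diamond\Delta_1,\neg\Box\Delta_2,\alpha$ / $\Box\Gamma_1,\neg\Diamond\Gamma_2\Rightarrow\Diamond\Delta_1,\neg\Box\Delta_2,\Box\alpha$. ($\Diamond$left) $\alpha,\Box\Gamma_1,\neg\Diamond\Gamma_2\Rightarrow\Diamond\Delta_1,\neg\Box\Delta_2$ / $\Diamond\alpha,\Box\Gamma_1,\neg\Diamond\Gamma_2\Rightarrow\Diamond\Delta_1,\neg\Box\Delta_2$. ($\Diamond$right) $\Gamma\Rightarrow\Delta,\alpha$ / $\Gamma\Rightarrow\Delta,\Diamond\alpha$. Twist rules: ($\neg\neg$left$^t$) $\alpha,\Gamma\Rightarrow\Delta$ / $\neg\neg\alpha,\Gamma\Rightarrow\Delta$. ($\neg\neg$right$^t$)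 $\Gamma\Rightarrow\Delta,\alpha$ / $\Gamma\Rightarrow\Delta,\neg\neg\alpha$. ($\neg\wedge$left$^t$) $\Gamma\Rightarrow\Delta,\alpha$; $\Gamma\Rightarrow\Delta,\beta$ / $\neg(\alpha\wedge\beta),\Gamma\Rightarrow\Delta$. ($\neg\wedge$right$^t$) $\alpha,\beta,\Gamma\Rightarrow\Delta$ / $\Gamma\Rightarrow\Delta,\neg(\alpha\wedge\beta)$. ($\neg\vee$left$^t$) $\Gamma\Rightarrow\Delta,\alpha,\beta$ / $\neg(\alpha\vee\beta),\Gamma\Rightarrow\Delta$. ($\neg\vee$right$^t$) $\alpha,\Gamma\Rightarrow\Delta$; $\beta,\Gamma\Rightarrow\Delta$ / $\Gamma\Rightarrow\Delta,\neg(\alpha\vee\beta)$. ($\neg\to$left$^t$) $\alpha,\Gamma\Rightarrow\Delta,\beta$ / $\neg(\alpha\to\beta),\Gamma\Rightarrow\Delta$. ($\neg\to$right$^t$) $\Gamma\Rightarrow\Delta,\alpha$; $\beta,\Gamma\Rightarrow\Delta$ / $\Gamma\Rightarrow\Delta,\neg(\alpha\to\beta)$. ($\neg\Box$left$^t$) $\Box\Gamma_1,\neg\Diamond\Gamma_2\Rightarrow\Diamond\Delta_1,\neg\Box\Delta_2,\alpha$ / $\neg\Box\alpha,\Box\Gamma_1,\neg\Diamond\Gamma_2\Rightarrow\Diamond\Delta_1,\neg\Box\Delta_2$. ($\neg\Box$right$^t$) $\alpha,\Gamma\Rightarrow\Delta$ / $\Gamma\Rightarrow\Delta,\neg\Box\alpha$.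 ($\neg\Diamond$left$^t$) $\Gamma\Rightarrow\Delta,\alpha$ / $\neg\Diamond\alpha,\Gamma\Rightarrow\Delta$. ($\neg\Diamond$right$^t$) $\alpha,\Box\Gamma_1,\neg\Diamond\Gamma_2\Rightarrow\Diamond\Delta_1,\neg\Box\Delta_2$ / $\Box\Gamma_1,\neg\Diamond\Gamma_2\Rightarrow\Diamond\Delta_1,\neg\Box\Delta_2,\neg\Diamond\alpha$. The calculus gTS4 is obtained from lTS4 by replacing ($\Box$right), ($\Diamond$left), ($\neg\Box$left$^t$), ($\neg\Diamond$right$^t$) with: ($\Box$right$^T$) $\Box\Gamma_1,\Box\Delta_2\Rightarrow\Diamond\Delta_1,\Diamond\Gamma_2,\alpha$ / $\Box\Gamma_1,\neg\Diamond\Gamma_2\Rightarrow\Diamond\Delta_1,\neg\Box\Delta_2,\Box\alpha$. ($\Diamond$left$^T$) $\alpha,\Box\Gamma_1,\Box\Delta_2\Rightarrow\Diamond\Delta_1,\Diamond\Gamma_2$ / $\Diamond\alpha,\Box\Gamma_1,\neg\Diamond\Gamma_2\Rightarrow\Diamond\Delta_1,\neg\Box\Delta_2$. ($\neg\Box$left$^T$) $\Box\Gamma_1,\Box\Delta_2\Rightarrow\Diamond\Delta_1,\Diamond\Gamma_2,\alpha$ / $\neg\Box\alpha,\Box\Gamma_1,\neg\Diamond\Gamma_2\Rightarrow\Diamond\Delta_1,\neg\Box\Delta_2$. ($\neg\Diamond$right$^T$) $\alpha,\Box\Gamma_1,\Box\Delta_2\Rightarrow\Diamond\Delta_1,\Diamond\Gamma_2$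 / $\Box\Gamma_1,\neg\Diamond\Gamma_2\Rightarrow\Diamond\Delta_1,\neg\Box\Delta_2,\neg\Diamond\alpha$. (All other rules and initial sequents of lTS4, including ($\neg\Diamond$left$^t$), are kept.) The calculus GS4 (Kripke's calculus for S4): initial sequents $p\Rightarrow p$ for every propositional variable $p$; rules (cut), (we-left), (we-right), ($\wedge$left), ($\wedge$right), ($\vee$left), ($\vee$right), ($\to$left), ($\to$right), ($\Box$left), ($\Diamond$right) exactly as in lTS4, together with: ($\neg$left) $\Gamma\Rightarrow\Delta,\alpha$ / $\neg\alpha,\Gamma\Rightarrow\Delta$. ($\neg$right) $\alpha,\Gamma\Rightarrow\Delta$ / $\Gamma\Rightarrow\Delta,\neg\alpha$. ($\Box$right$^k$) $\Box\Gamma\Rightarrow\Diamond\Delta,\alpha$ / $\Box\Gamma\Rightarrow\Diamond\Delta,\Box\alpha$. ($\Diamond$left$^k$) $\alpha,\Box\Gamma\Rightarrow\Diamond\Delta$ / $\Diamond\alpha,\Box\Gamma\Rightarrow\Diamond\Delta$. GS4 has no twist rules and no other rules. -}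

module Defs where

open import Data.Nat using (ℕ)
open import Data.List using (List; []; _∷_; _++_; map)
open import Data.List.Membership.Propositional using (_∈_)
open import Function.Bundles using (_⇔_)

data Fm : Set where
  var  : ℕ → Fm
  _∧_  : Fm → Fm → Fm
  _∨_  : Fm → Fm → Fm
  _⇒_  : Fm → Fm → Fm
  ¬'   : Fm → Fm
  □    : Fm → Fm
  ◇    : Fm → Fm

-- Finite sets of formulas are represented by lists; two lists denote the
-- same set iff they have the same members.  Sequents are taken modulo this
-- equality (rule set-eq below), so "," is union.
Ctx : Set
Ctx = List Fm

_≈ˢ_ : Ctx → Ctx → Set
Γ ≈ˢ Γ' = ∀ x → (x ∈ Γ) ⇔ (x ∈ Γ')

□s ¬◇s ◇s ¬□s : Ctx → Ctx
□s  = map □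
◇s  = map ◇
¬◇s = map (λ a → ¬' (◇ a))
¬□s = map (λ a → ¬' (□ a))

-- The two twist calculi lTS4 and gTS4 share all rules except four modal ones.
data Variant : Set where
  lTS4 gTS4 : Variant

infix 3 TS4⊢_⟹_ GS4⊢_⟹_

data TS4⊢_⟹_ : {L : Variant} → Ctx → Ctx → Set where
  set-eq : ∀ {L} {Γ Δ Γ' Δ'} → Γ ≈ˢ Γ' → Δ ≈ˢ Δ' → TS4⊢_⟹_ {L} Γ Δ → TS4⊢_⟹_ {L} Γ' Δ'
  ax1 : ∀ {L} p → TS4⊢_⟹_ {L} (var p ∷ []) (var p ∷ [])
  ax2 : ∀ {L} p → TS4⊢_⟹_ {L} (¬' (var p) ∷ []) (¬' (var p) ∷ [])
  ax3 : ∀ {L} p → TS4⊢_⟹_ {L} (¬' (var p) ∷ var p ∷ []) []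
  ax4 : ∀ {L} p → TS4⊢_⟹_ {L} [] (¬' (var p) ∷ var p ∷ [])
  cut : ∀ {L} {Γ Δ α} → TS4⊢_⟹_ {L} Γ (α ∷ []) → TS4⊢_⟹_ {L} (α ∷ Γ) Δ → TS4⊢_⟹_ {L} Γ Δ
  weL : ∀ {L} {Γ Δ α} → TS4⊢_⟹_ {L} Γ Δ → TS4⊢_⟹_ {L} (α ∷ Γ) Δ
  weR : ∀ {L} {Γ Δ α} → TS4⊢_⟹_ {L} Γ Δ → TS4⊢_⟹_ {L} Γ (Δ ++ α ∷ [])
  ∧L : ∀ {L} {Γ Δ α β} → TS4⊢_⟹_ {L} (α ∷ β ∷ Γ) Δ → TS4⊢_⟹_ {L} ((α ∧ β) ∷ Γ) Δ
  ∧R : ∀ {L} {Γ Δ α β} → TS4⊢_⟹_ {L} Γ (Δ ++ α ∷ []) → TS4⊢_⟹_ {L} Γ (Δ ++ β ∷ [])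
       → TS4⊢_⟹_ {L} Γ (Δ ++ (α ∧ β) ∷ [])
  ∨L : ∀ {L} {Γ Δ α β} → TS4⊢_⟹_ {L} (α ∷ Γ) Δ → TS4⊢_⟹_ {L} (β ∷ Γ) Δ
       → TS4⊢_⟹_ {L} ((α ∨ β) ∷ Γ) Δ
  ∨R : ∀ {L} {Γ Δ α β} → TS4⊢_⟹_ {L} Γ (Δ ++ α ∷ β ∷ []) → TS4⊢_⟹_ {L} Γ (Δ ++ (α ∨ β) ∷ [])
  →L : ∀ {L} {Γ Δ α β} → TS4⊢_⟹_ {L} Γ (Δ ++ α ∷ []) → TS4⊢_⟹_ {L} (β ∷ Γ) Δ
       → TS4⊢_⟹_ {L} ((α ⇒ β) ∷ Γ) Δ
  →R : ∀ {L} {Γ Δ α β} → TS4⊢_⟹_ {L} (α ∷ Γ) (Δ ++ β ∷ []) → TS4⊢_⟹_ {L} Γ (Δ ++ (α ⇒ β) ∷ [])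
  □L : ∀ {L} {Γ Δ α} → TS4⊢_⟹_ {L} (α ∷ Γ) Δ → TS4⊢_⟹_ {L} (□ α ∷ Γ) Δ
  ◇R : ∀ {L} {Γ Δ α} → TS4⊢_⟹_ {L} Γ (Δ ++ α ∷ []) → TS4⊢_⟹_ {L} Γ (Δ ++ ◇ α ∷ [])
  □R : ∀ {Γ₁ Γ₂ Δ₁ Δ₂ α} →
       TS4⊢_⟹_ {lTS4} (□s Γ₁ ++ ¬◇s Γ₂) (◇s Δ₁ ++ ¬□s Δ₂ ++ α ∷ []) →
       TS4⊢_⟹_ {lTS4} (□s Γ₁ ++ ¬◇s Γ₂) (◇s Δ₁ ++ ¬□s Δ₂ ++ □ α ∷ [])
  ◇L : ∀ {Γ₁ Γ₂ Δ₁ Δ₂ α} →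
       TS4⊢_⟹_ {lTS4} (α ∷ □s Γ₁ ++ ¬◇s Γ₂) (◇s Δ₁ ++ ¬□s Δ₂) →
       TS4⊢_⟹_ {lTS4} (◇ α ∷ □s Γ₁ ++ ¬◇s Γ₂) (◇s Δ₁ ++ ¬□s Δ₂)
  ¬□Lt : ∀ {Γ₁ Γ₂ Δ₁ Δ₂ α} →
       TS4⊢_⟹_ {lTS4} (□s Γ₁ ++ ¬◇s Γ₂) (◇s Δ₁ ++ ¬□s Δ₂ ++ α ∷ []) →
       TS4⊢_⟹_ {lTS4} (¬' (□ α) ∷ □s Γ₁ ++ ¬◇s Γ₂) (◇s Δ₁ ++ ¬□s Δ₂)
  ¬◇Rt : ∀ {Γ₁ Γ₂ Δ₁ Δ₂ α} →
       TS4⊢_⟹_ {lTS4} (α ∷ □s Γ₁ ++ ¬◇s Γ₂) (◇s Δ₁ ++ ¬□s Δ₂) →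
       TS4⊢_⟹_ {lTS4} (□s Γ₁ ++ ¬◇s Γ₂) (◇s Δ₁ ++ ¬□s Δ₂ ++ ¬' (◇ α) ∷ [])
  □RT : ∀ {Γ₁ Γ₂ Δ₁ Δ₂ α} →
       TS4⊢_⟹_ {gTS4} (□s Γ₁ ++ □s Δ₂) (◇s Δ₁ ++ ◇s Γ₂ ++ α ∷ []) →
       TS4⊢_⟹_ {gTS4} (□s Γ₁ ++ ¬◇s Γ₂) (◇s Δ₁ ++ ¬□s Δ₂ ++ □ α ∷ [])
  ◇LT : ∀ {Γ₁ Γ₂ Δ₁ Δ₂ α} →
       TS4⊢_⟹_ {gTS4} (α ∷ □s Γ₁ ++ □s Δ₂) (◇s Δ₁ ++ ◇s Γ₂) →
       TS4⊢_⟹_ {gTS4} (◇ α ∷ □s Γ₁ ++ ¬◇s Γ₂) (◇s Δ₁ ++ ¬□s Δ₂)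
  ¬□LT : ∀ {Γ₁ Γ₂ Δ₁ Δ₂ α} →
       TS4⊢_⟹_ {gTS4} (□s Γ₁ ++ □s Δ₂) (◇s Δ₁ ++ ◇s Γ₂ ++ α ∷ []) →
       TS4⊢_⟹_ {gTS4} (¬' (□ α) ∷ □s Γ₁ ++ ¬◇s Γ₂) (◇s Δ₁ ++ ¬□s Δ₂)
  ¬◇RT : ∀ {Γ₁ Γ₂ Δ₁ Δ₂ α} →
       TS4⊢_⟹_ {gTS4} (α ∷ □s Γ₁ ++ □s Δ₂) (◇s Δ₁ ++ ◇s Γ₂) →
       TS4⊢_⟹_ {gTS4} (□s Γ₁ ++ ¬◇s Γ₂) (◇s Δ₁ ++ ¬□s Δ₂ ++ ¬' (◇ α) ∷ [])
  ¬¬L : ∀ {L} {Γ Δ α} → TS4⊢_⟹_ {L} (α ∷ Γ) Δ → TS4⊢_⟹_ {L} (¬' (¬' α) ∷ Γ) Δ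
  ¬¬R : ∀ {L} {Γ Δ α} → TS4⊢_⟹_ {L} Γ (Δ ++ α ∷ []) → TS4⊢_⟹_ {L} Γ (Δ ++ ¬' (¬' α) ∷ [])
  ¬∧L : ∀ {L} {Γ Δ α β} → TS4⊢_⟹_ {L} Γ (Δ ++ α ∷ []) → TS4⊢_⟹_ {L} Γ (Δ ++ β ∷ [])
        → TS4⊢_⟹_ {L} (¬' (α ∧ β) ∷ Γ) Δ
  ¬∧R : ∀ {L} {Γ Δ α β} → TS4⊢_⟹_ {L} (α ∷ β ∷ Γ) Δ → TS4⊢_⟹_ {L} Γ (Δ ++ ¬' (α ∧ β) ∷ [])
  ¬∨L : ∀ {L} {Γ Δ α β} → TS4⊢_⟹_ {L} Γ (Δ ++ α ∷ β ∷ []) → TS4⊢_⟹_ {L} (¬' (α ∨ β) ∷ Γ) Δ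
  ¬∨R : ∀ {L} {Γ Δ α β} → TS4⊢_⟹_ {L} (α ∷ Γ) Δ → TS4⊢_⟹_ {L} (β ∷ Γ) Δ
        → TS4⊢_⟹_ {L} Γ (Δ ++ ¬' (α ∨ β) ∷ [])
  ¬→L : ∀ {L} {Γ Δ α β} → TS4⊢_⟹_ {L} (α ∷ Γ) (Δ ++ β ∷ []) → TS4⊢_⟹_ {L} (¬' (α ⇒ β) ∷ Γ) Δ
  ¬→R : ∀ {L} {Γ Δ α β} → TS4⊢_⟹_ {L} Γ (Δ ++ α ∷ []) → TS4⊢_⟹_ {L} (β ∷ Γ) Δ
        → TS4⊢_⟹_ {L} Γ (Δ ++ ¬' (α ⇒ β) ∷ [])
  ¬□R : ∀ {L} {Γ Δ α} → TS4⊢_⟹_ {L} (α ∷ Γ) Δ → TS4⊢_⟹_ {L} Γ (Δ ++ ¬' (□ α) ∷ [])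
  ¬◇L : ∀ {L} {Γ Δ α} → TS4⊢_⟹_ {L} Γ (Δ ++ α ∷ []) → TS4⊢_⟹_ {L} (¬' (◇ α) ∷ Γ) Δ

data GS4⊢_⟹_ : Ctx → Ctx → Set where
  set-eq : ∀ {Γ Δ Γ' Δ'} → Γ ≈ˢ Γ' → Δ ≈ˢ Δ' → GS4⊢ Γ ⟹ Δ → GS4⊢ Γ' ⟹ Δ'
  ax : ∀ p → GS4⊢ var p ∷ [] ⟹ var p ∷ []
  cut : ∀ {Γ Δ α} → GS4⊢ Γ ⟹ α ∷ [] → GS4⊢ α ∷ Γ ⟹ Δ → GS4⊢ Γ ⟹ Δ
  weL : ∀ {Γ Δ α} → GS4⊢ Γ ⟹ Δ → GS4⊢ α ∷ Γ ⟹ Δ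
  weR : ∀ {Γ Δ α} → GS4⊢ Γ ⟹ Δ → GS4⊢ Γ ⟹ Δ ++ α ∷ []
  ∧L : ∀ {Γ Δ α β} → GS4⊢ α ∷ β ∷ Γ ⟹ Δ → GS4⊢ (α ∧ β) ∷ Γ ⟹ Δ
  ∧R : ∀ {Γ Δ α β} → GS4⊢ Γ ⟹ Δ ++ α ∷ [] → GS4⊢ Γ ⟹ Δ ++ β ∷ [] → GS4⊢ Γ ⟹ Δ ++ (α ∧ β) ∷ []
  ∨L : ∀ {Γ Δ α β} → GS4⊢ α ∷ Γ ⟹ Δ → GS4⊢ β ∷ Γ ⟹ Δ → GS4⊢ (α ∨ β) ∷ Γ ⟹ Δ
  ∨R : ∀ {Γ Δ α β} → GS4⊢ Γ ⟹ Δ ++ α ∷ β ∷ [] → GS4⊢ Γ ⟹ Δ ++ (α ∨ β) ∷ []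
  →L : ∀ {Γ Δ α β} → GS4⊢ Γ ⟹ Δ ++ α ∷ [] → GS4⊢ β ∷ Γ ⟹ Δ → GS4⊢ (α ⇒ β) ∷ Γ ⟹ Δ
  →R : ∀ {Γ Δ α β} → GS4⊢ α ∷ Γ ⟹ Δ ++ β ∷ [] → GS4⊢ Γ ⟹ Δ ++ (α ⇒ β) ∷ []
  □L : ∀ {Γ Δ α} → GS4⊢ α ∷ Γ ⟹ Δ → GS4⊢ □ α ∷ Γ ⟹ Δ
  ◇R : ∀ {Γ Δ α} → GS4⊢ Γ ⟹ Δ ++ α ∷ [] → GS4⊢ Γ ⟹ Δ ++ ◇ α ∷ []
  ¬L : ∀ {Γ Δ α} → GS4⊢ Γ ⟹ Δ ++ α ∷ [] → GS4⊢ ¬' α ∷ Γ ⟹ Δ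
  ¬R : ∀ {Γ Δ α} → GS4⊢ α ∷ Γ ⟹ Δ → GS4⊢ Γ ⟹ Δ ++ ¬' α ∷ []
  □Rk : ∀ {Γ Δ α} → GS4⊢ □s Γ ⟹ ◇s Δ ++ α ∷ [] → GS4⊢ □s Γ ⟹ ◇s Δ ++ □ α ∷ []
  ◇Lk : ∀ {Γ Δ α} → GS4⊢ α ∷ □s Γ ⟹ ◇s Δ → GS4⊢ ◇ α ∷ □s Γ ⟹ ◇s Δ

-- GS4 into lTS4 and gTS4: by induction on α, both calculi derive α ⇒ α, ¬α, α ⇒ and ⇒ ¬α, α;
-- with cut the last two make GS4's negation rules admissible, indeed invertible.
--
-- lTS4 and gTS4 into GS4: each propositional twist rule is a GS4 negation rule composed with the
-- rule for the connective. For the modal rules, negation is invertible in GS4, so moving ¬◇γ from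
-- the antecedent to ◇γ in the succedent and ¬□δ from the succedent to □δ in the antecedent
-- preserves derivability. This turns the premise of each lTS4 modal rule into that of the
-- corresponding gTS4 rule, and the conclusion of each gTS4 rule into a sequent obtained from its
-- premise by a Kripke rule (followed by a negation rule in the case of ¬□ and ¬◇).

module Submission where

open import Defs
open import Data.List using ([]; _∷_; _++_; map; [_])
open import Data.List.Properties using (++-assoc; ++-identityʳ; map-++)
open import Data.List.Membership.Propositional using (_∈_)
open import Data.List.Membership.Propositional.Properties using (∈-++⁻)
open import Data.List.Relation.Unary.Any using (here; there)
open import Data.List.Relation.Unary.All using (All; []; _∷_; lookup)
open import Data.List.Relation.Binary.Subset.Propositional using (_⊆_)
open import Data.List.Relation.Binary.Subset.Propositional.Properties
  using (⊆-refl; ⊆-reflexive-↭; xs⊆xs++ys; xs⊆ys++xs)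
open import Data.List.Relation.Binary.Permutation.Propositional
  using (_↭_; ↭-refl; ↭-sym; ↭-trans; ↭-swap)
import Data.List.Relation.Binary.Permutation.Propositional.Properties as ↭
open import Data.Sum using ([_,_]′)
open import Function using (_∘_)
open import Function.Bundles using (_⇔_; mk⇔; Equivalence)
open Equivalence using (to; from)
import Function.Properties.Equivalence as ⇔
open import Relation.Binary.PropositionalEquality using (_≡_; refl; sym; trans; cong; subst)

pattern ∈₀ = here refl
pattern ∈₁ = there ∈₀
pattern ∈₂ = there ∈₁

⊆[_] : ∀ {A B : Ctx} → All (_∈ B) A → A ⊆ B
⊆[_] = lookup

⊆-++ : ∀ {A B C : Ctx} → A ⊆ C → B ⊆ C → A ++ B ⊆ C
⊆-++ {A} s t p = [ s , t ]′ (∈-++⁻ A p)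

∷⊆∷ʳ : ∀ (α : Fm) Δ → α ∷ Δ ⊆ Δ ++ [ α ]
∷⊆∷ʳ α Δ = ⊆-reflexive-↭ (↭.∷↭∷ʳ α Δ)

∷ʳ⊆∷ : ∀ (α : Fm) Δ → Δ ++ [ α ] ⊆ α ∷ Δ
∷ʳ⊆∷ α Δ = ⊆-reflexive-↭ (↭-sym (↭.∷↭∷ʳ α Δ))

++-rotate : ∀ (A B C : Ctx) → A ++ B ++ C ↭ C ++ A ++ B
++-rotate A B C = ↭-trans (↭-sym (↭.++-assoc A B C)) (↭.++-comm (A ++ B) C)

◇s-++ : ∀ Δ Δ′ Y → ◇s Δ ++ ◇s Δ′ ++ Y ≡ ◇s (Δ ++ Δ′) ++ Y
◇s-++ Δ Δ′ Y = trans (sym (++-assoc (◇s Δ) (◇s Δ′) Y)) (cong (_++ Y) (sym (map-++ ◇ Δ Δ′)))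

module Structural
  (_⊢_ : Ctx → Ctx → Set)
  (≈ˢ-resp : ∀ {Γ Δ Γ′ Δ′} → Γ ≈ˢ Γ′ → Δ ≈ˢ Δ′ → Γ ⊢ Δ → Γ′ ⊢ Δ′)
  (cut₁ : ∀ {Γ Δ α} → Γ ⊢ (α ∷ []) → (α ∷ Γ) ⊢ Δ → Γ ⊢ Δ)
  (weakenˡ : ∀ {Γ Δ α} → Γ ⊢ Δ → (α ∷ Γ) ⊢ Δ)
  (weakenʳ : ∀ {Γ Δ α} → Γ ⊢ Δ → Γ ⊢ (Δ ++ α ∷ []))
  (∨-left : ∀ {Γ Δ α β} → (α ∷ Γ) ⊢ Δ → (β ∷ Γ) ⊢ Δ → ((α ∨ β) ∷ Γ) ⊢ Δ)
  (∨-right : ∀ {Γ Δ α β} → Γ ⊢ (Δ ++ α ∷ β ∷ []) → Γ ⊢ (Δ ++ (α ∨ β) ∷ []))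
  where

  exchange : ∀ {Γ Δ Γ′ Δ′} → Γ ↭ Γ′ → Δ ↭ Δ′ → Γ ⊢ Δ → Γ′ ⊢ Δ′
  exchange σ τ = ≈ˢ-resp (↭⇒≈ˢ σ) (↭⇒≈ˢ τ)
    where
    ↭⇒≈ˢ : ∀ {A B : Ctx} → A ↭ B → A ≈ˢ B
    ↭⇒≈ˢ π _ = mk⇔ (⊆-reflexive-↭ π) (⊆-reflexive-↭ (↭-sym π))

  exchange⇔ : ∀ {Γ Δ Γ′ Δ′} → Γ ↭ Γ′ → Δ ↭ Δ′ → Γ ⊢ Δ ⇔ Γ′ ⊢ Δ′
  exchange⇔ σ τ = mk⇔ (exchange σ τ) (exchange (↭-sym σ) (↭-sym τ))

  swapˡ : ∀ {α β Γ Δ} → (α ∷ β ∷ Γ) ⊢ Δ → (β ∷ α ∷ Γ) ⊢ Δ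
  swapˡ = exchange (↭-swap _ _ ↭-refl) ↭-refl

  swapʳ : ∀ {α β Γ Δ} → Γ ⊢ (α ∷ β ∷ Δ) → Γ ⊢ (β ∷ α ∷ Δ)
  swapʳ = exchange ↭-refl (↭-swap _ _ ↭-refl)

  weakenˡ* : ∀ Π {Γ Δ} → Γ ⊢ Δ → (Π ++ Γ) ⊢ Δ
  weakenˡ* []      d = d
  weakenˡ* (_ ∷ Π) d = weakenˡ (weakenˡ* Π d)

  weakenʳ* : ∀ Π {Γ Δ} → Γ ⊢ Δ → Γ ⊢ (Δ ++ Π)
  weakenʳ* []      {Γ} {Δ} d = subst (Γ ⊢_) (sym (++-identityʳ Δ)) d
  weakenʳ* (α ∷ Π) {Γ} {Δ} d = subst (Γ ⊢_) (++-assoc Δ [ α ] Π) (weakenʳ* Π (weakenʳ d))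

  weaken : ∀ {Γ Δ Γ′ Δ′} → Γ ⊆ Γ′ → Δ ⊆ Δ′ → Γ ⊢ Δ → Γ′ ⊢ Δ′
  weaken {Γ} {Δ} {Γ′} {Δ′} s t d =
    ≈ˢ-resp (λ _ → mk⇔ (⊆-++ ⊆-refl s) (xs⊆xs++ys Γ′ Γ))
            (λ _ → mk⇔ (⊆-++ t ⊆-refl) (xs⊆ys++xs Δ′ Δ))
            (weakenʳ* Δ′ (weakenˡ* Γ′ d))

  weaken∈ : ∀ {α β Γ Δ} → (α ∷ []) ⊢ (β ∷ []) → α ∈ Γ → β ∈ Δ → Γ ⊢ Δ
  weaken∈ d p q = weaken (⊆[ p ∷ [] ]) (⊆[ q ∷ [] ]) d

  transfer : ∀ (f g : Fm → Fm) → (∀ {x Γ Δ} → (f x ∷ Γ) ⊢ Δ ⇔ Γ ⊢ (g x ∷ Δ))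
           → ∀ xs {Γ Δ} → (map f xs ++ Γ) ⊢ Δ ⇔ Γ ⊢ (map g xs ++ Δ)
  transfer f g step []       = ⇔.refl
  transfer f g step (x ∷ xs) {Γ} {Δ} =
    ⇔.trans step (⇔.trans (transfer f g step xs) (exchange⇔ ↭-refl (↭.shift (g x) (map g xs) Δ)))

  module WithIdentity (identity : ∀ α → (α ∷ []) ⊢ (α ∷ [])) where

    ⋁ : Fm → Ctx → Fm
    ⋁ α []      = α
    ⋁ α (β ∷ Δ) = α ∨ ⋁ β Δ

    ⋁-right : ∀ Π α Δ {Γ} → Γ ⊢ (Π ++ α ∷ Δ) → Γ ⊢ (Π ++ ⋁ α Δ ∷ [])
    ⋁-right Π α []      d = d
    ⋁-right Π α (β ∷ Δ) {Γ} d =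
      ∨-right (subst (Γ ⊢_) (++-assoc Π [ α ] _)
        (⋁-right (Π ++ [ α ]) β Δ (subst (Γ ⊢_) (sym (++-assoc Π [ α ] (β ∷ Δ))) d)))

    ⋁-left : ∀ α Δ {Γ Σ} → (∀ {β} → β ∈ α ∷ Δ → (β ∷ Γ) ⊢ Σ) → (⋁ α Δ ∷ Γ) ⊢ Σ
    ⋁-left α []      h = h ∈₀
    ⋁-left α (β ∷ Δ) h = ∨-left (h ∈₀) (⋁-left β Δ (h ∘ there))

    -- cut with a side context Δ in the succedent: the single-succedent cut is applied to ⋁ (α ∷ Δ)
    cutΔ : ∀ {Γ Δ α} → Γ ⊢ (Δ ++ α ∷ []) → (α ∷ Γ) ⊢ Δ → Γ ⊢ Δ
    cutΔ {Γ} {Δ} {α} d e = cut₁ (⋁-right [] α Δ (weaken ⊆-refl (∷ʳ⊆∷ α Δ) d)) (⋁-left α Δ closes)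
      where
      closes : ∀ {β} → β ∈ α ∷ Δ → (β ∷ Γ) ⊢ Δ
      closes ∈₀        = e
      closes (there p) = weaken∈ (identity _) ∈₀ p

    module Negation
      (noncontradiction : ∀ α → (¬' α ∷ α ∷ []) ⊢ [])
      (excluded-middle : ∀ α → [] ⊢ (¬' α ∷ α ∷ []))
      where

      ¬-flipˡ : ∀ {α Γ Δ} → (¬' α ∷ Γ) ⊢ Δ ⇔ Γ ⊢ (α ∷ Δ)
      ¬-flipˡ {α} {Γ} {Δ} = mk⇔
        (λ d → cutΔ (weaken (λ ()) (⊆[ xs⊆ys++xs _ (α ∷ Δ) ∈₀ ∷ ∈₀ ∷ [] ]) (excluded-middle α))
                    (weaken ⊆-refl there d))
        (λ d → cutΔ (weaken there (∷⊆∷ʳ _ Δ) d)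
                    (weaken (⊆[ ∈₁ ∷ ∈₀ ∷ [] ]) (λ ()) (noncontradiction α)))

      ¬-flipʳ : ∀ {α Γ Δ} → (α ∷ Γ) ⊢ Δ ⇔ Γ ⊢ (¬' α ∷ Δ)
      ¬-flipʳ {α} {Γ} {Δ} = mk⇔
        (λ d → cutΔ (weaken (λ ()) (⊆[ ∈₀ ∷ xs⊆ys++xs _ (¬' α ∷ Δ) ∈₀ ∷ [] ]) (excluded-middle α))
                    (weaken ⊆-refl there d))
        (λ d → cutΔ (weaken there (∷⊆∷ʳ _ Δ) d)
                    (weaken (⊆[ ∈₀ ∷ ∈₁ ∷ [] ]) (λ ()) (noncontradiction α)))

module TS4-structural {L : Variant} = Structural (TS4⊢_⟹_ {L}) set-eq cut weL weR ∨L ∨R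

module TS4-simulates-GS4 where
  open TS4-structural

  ++[]ˡ : ∀ {L Γ Δ} → TS4⊢_⟹_ {L} (Γ ++ []) Δ ⇔ TS4⊢_⟹_ {L} Γ Δ
  ++[]ˡ = exchange⇔ (↭.++-identityʳ _) ↭-refl

  ++[]ʳ : ∀ {L Γ Δ} → TS4⊢_⟹_ {L} Γ (Δ ++ []) ⇔ TS4⊢_⟹_ {L} Γ Δ
  ++[]ʳ = exchange⇔ ↭-refl (↭.++-identityʳ _)

  □Rₖ : ∀ {L} Γ Δ {α} → TS4⊢_⟹_ {L} (□s Γ) (◇s Δ ++ α ∷ []) → TS4⊢_⟹_ {L} (□s Γ) (◇s Δ ++ □ α ∷ [])
  □Rₖ {lTS4} Γ Δ = to ++[]ˡ ∘ □R {Γ₁ = Γ} {[]} {Δ} {[]} ∘ from ++[]ˡ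
  □Rₖ {gTS4} Γ Δ = to ++[]ˡ ∘ □RT {Γ₁ = Γ} {[]} {Δ} {[]} ∘ from ++[]ˡ

  ◇Lₖ : ∀ {L} Γ Δ {α} → TS4⊢_⟹_ {L} (α ∷ □s Γ) (◇s Δ) → TS4⊢_⟹_ {L} (◇ α ∷ □s Γ) (◇s Δ)
  ◇Lₖ {lTS4} Γ Δ = to ++[]ˡ ∘ to ++[]ʳ ∘ ◇L {Γ₁ = Γ} {[]} {Δ} {[]} ∘ from ++[]ʳ ∘ from ++[]ˡ
  ◇Lₖ {gTS4} Γ Δ = to ++[]ˡ ∘ to ++[]ʳ ∘ ◇LT {Γ₁ = Γ} {[]} {Δ} {[]} ∘ from ++[]ʳ ∘ from ++[]ˡ

  mutual
    identity : ∀ {L} α → TS4⊢_⟹_ {L} (α ∷ []) (α ∷ [])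
    identity (var p) = ax1 p
    identity (a ∧ b) = ∧L (∧R {Δ = []} (weaken∈ (identity a) ∈₀ ∈₀) (weaken∈ (identity b) ∈₁ ∈₀))
    identity (a ∨ b) = ∨R {Δ = []} (∨L (weaken∈ (identity a) ∈₀ ∈₀) (weaken∈ (identity b) ∈₀ ∈₁))
    identity (a ⇒ b) = →R {Δ = []} (modus-ponens a b)
    identity (¬' a)  = identity¬ a
    identity (□ a)   = □Rₖ (a ∷ []) [] (□L (identity a))
    identity (◇ a)   = ◇Lₖ [] (a ∷ []) (◇R {Δ = []} (identity a))

    modus-ponens : ∀ {L} a b → TS4⊢_⟹_ {L} (a ∷ (a ⇒ b) ∷ []) (b ∷ [])
    modus-ponens a b =
      swapˡ (→L {Γ = a ∷ []} {Δ = b ∷ []} (weaken∈ (identity a) ∈₀ ∈₁) (weaken∈ (identity b) ∈₀ ∈₀))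

    ¬∧-absurd : ∀ {L} a b → TS4⊢_⟹_ {L} (a ∷ b ∷ ¬' (a ∧ b) ∷ []) []
    ¬∧-absurd a b = weaken ⊆[ ∈₂ ∷ ∈₀ ∷ ∈₁ ∷ [] ] ⊆-refl
      (¬∧L {Γ = a ∷ b ∷ []} {Δ = []} (weaken∈ (identity a) ∈₀ ∈₀) (weaken∈ (identity b) ∈₁ ∈₀))

    ¬∨-absurd : ∀ {L} a b {c} → c ∈ a ∷ b ∷ [] → TS4⊢_⟹_ {L} (c ∷ ¬' (a ∨ b) ∷ []) []
    ¬∨-absurd a b {c} c∈ = swapˡ (¬∨L {Γ = c ∷ []} {Δ = []} (weaken∈ (identity c) ∈₀ c∈))

    ¬⇒-intro : ∀ {L} a b → TS4⊢_⟹_ {L} (a ∷ []) (¬' (a ⇒ b) ∷ b ∷ [])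
    ¬⇒-intro a b =
      swapʳ (¬→R {Γ = a ∷ []} {Δ = b ∷ []} (weaken∈ (identity a) ∈₀ ∈₁) (weaken∈ (identity b) ∈₀ ∈₀))

    ¬□-intro : ∀ {L} a → TS4⊢_⟹_ {L} [] (¬' (□ a) ∷ a ∷ [])
    ¬□-intro a = swapʳ (¬□R {Γ = []} {Δ = a ∷ []} (identity a))

    ¬◇-absurd : ∀ {L} a → TS4⊢_⟹_ {L} (a ∷ ¬' (◇ a) ∷ []) []
    ¬◇-absurd a = swapˡ (¬◇L {Γ = a ∷ []} {Δ = []} (identity a))

    identity¬ : ∀ {L} α → TS4⊢_⟹_ {L} (¬' α ∷ []) (¬' α ∷ [])
    identity¬ (var p) = ax2 p
    identity¬ (a ∧ b) = ¬∧R {Γ = ¬' (a ∧ b) ∷ []} {Δ = []} (¬∧-absurd a b)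
    identity¬ (a ∨ b) = ¬∨R {Γ = ¬' (a ∨ b) ∷ []} {Δ = []} (¬∨-absurd a b ∈₀) (¬∨-absurd a b ∈₁)
    identity¬ (a ⇒ b) = ¬→L {Γ = []} {Δ = ¬' (a ⇒ b) ∷ []} (¬⇒-intro a b)
    identity¬ (¬' a)  = ¬¬L {Γ = []} {Δ = ¬' (¬' a) ∷ []} (¬¬R {Δ = []} (identity a))
    identity¬ {lTS4} (□ a) = ¬□Lt {Γ₁ = []} {[]} {[]} {a ∷ []} (¬□-intro a)
    identity¬ {gTS4} (□ a) = ¬□LT {Γ₁ = []} {[]} {[]} {a ∷ []} (□L (identity a))
    identity¬ {lTS4} (◇ a) = ¬◇Rt {Γ₁ = []} {a ∷ []} {[]} {[]} (¬◇-absurd a)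
    identity¬ {gTS4} (◇ a) = ¬◇RT {Γ₁ = []} {a ∷ []} {[]} {[]} (◇R {Δ = []} (identity a))

  noncontradiction : ∀ {L} α → TS4⊢_⟹_ {L} (¬' α ∷ α ∷ []) []
  noncontradiction (var p) = ax3 p
  noncontradiction (a ∧ b) = swapˡ (∧L {Γ = ¬' (a ∧ b) ∷ []} (¬∧-absurd a b))
  noncontradiction (a ∨ b) = swapˡ (∨L {Γ = ¬' (a ∨ b) ∷ []} (¬∨-absurd a b ∈₀) (¬∨-absurd a b ∈₁))
  noncontradiction (a ⇒ b) = ¬→L {Γ = (a ⇒ b) ∷ []} {Δ = []} (modus-ponens a b)
  noncontradiction (¬' a)  = ¬¬L {Γ = ¬' a ∷ []} (swapˡ (noncontradiction a))
  noncontradiction {lTS4} (□ a) = ¬□Lt {Γ₁ = a ∷ []} {[]} {[]} {[]} (□L (identity a))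
  noncontradiction {gTS4} (□ a) = ¬□LT {Γ₁ = a ∷ []} {[]} {[]} {[]} (□L (identity a))
  noncontradiction {lTS4} (◇ a) = swapˡ (◇L {Γ₁ = []} {a ∷ []} {[]} {[]} (¬◇-absurd a))
  noncontradiction {gTS4} (◇ a) = swapˡ (◇LT {Γ₁ = []} {a ∷ []} {[]} {[]} (◇R {Δ = []} (identity a)))

  excluded-middle : ∀ {L} α → TS4⊢_⟹_ {L} [] (¬' α ∷ α ∷ [])
  excluded-middle (var p) = ax4 p
  excluded-middle (a ∧ b) = ∧R {Δ = ¬' (a ∧ b) ∷ []}
    (swapʳ (¬∧R {Γ = []} {Δ = a ∷ []} (weaken∈ (identity a) ∈₀ ∈₀)))
    (swapʳ (¬∧R {Γ = []} {Δ = b ∷ []} (weaken∈ (identity b) ∈₁ ∈₀)))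
  excluded-middle (a ∨ b) = ∨R {Δ = ¬' (a ∨ b) ∷ []} (weaken ⊆-refl ⊆[ ∈₁ ∷ ∈₂ ∷ ∈₀ ∷ [] ]
    (¬∨R {Γ = []} {Δ = a ∷ b ∷ []} (weaken∈ (identity a) ∈₀ ∈₀) (weaken∈ (identity b) ∈₀ ∈₁)))
  excluded-middle (a ⇒ b) = →R {Γ = []} {Δ = ¬' (a ⇒ b) ∷ []} (¬⇒-intro a b)
  excluded-middle (¬' a)  = swapʳ (¬¬R {Δ = ¬' a ∷ []} (excluded-middle a))
  excluded-middle {lTS4} (□ a) = □R {Γ₁ = []} {[]} {[]} {a ∷ []} (¬□-intro a)
  excluded-middle {gTS4} (□ a) = □RT {Γ₁ = []} {[]} {[]} {a ∷ []} (□L (identity a))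
  excluded-middle {lTS4} (◇ a) = swapʳ (¬◇Rt {Γ₁ = []} {[]} {a ∷ []} {[]} (◇R {Δ = []} (identity a)))
  excluded-middle {gTS4} (◇ a) = swapʳ (¬◇RT {Γ₁ = []} {[]} {a ∷ []} {[]} (◇R {Δ = []} (identity a)))

  module TS4-cut {L : Variant} = WithIdentity {L} identity
  open module TS4-negation {L : Variant} = TS4-cut.Negation {L} noncontradiction excluded-middle

  ¬L-admissible : ∀ {L Γ Δ α} → TS4⊢_⟹_ {L} Γ (Δ ++ α ∷ []) → TS4⊢_⟹_ {L} (¬' α ∷ Γ) Δ
  ¬L-admissible {Δ = Δ} d = from ¬-flipˡ (weaken ⊆-refl (∷ʳ⊆∷ _ Δ) d)

  ¬R-admissible : ∀ {L Γ Δ α} → TS4⊢_⟹_ {L} (α ∷ Γ) Δ → TS4⊢_⟹_ {L} Γ (Δ ++ ¬' α ∷ [])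
  ¬R-admissible {Δ = Δ} d = weaken ⊆-refl (∷⊆∷ʳ _ Δ) (to ¬-flipʳ d)

  fromGS4 : ∀ {L Γ Δ} → GS4⊢ Γ ⟹ Δ → TS4⊢_⟹_ {L} Γ Δ
  fromGS4 (set-eq p q d) = set-eq p q (fromGS4 d)
  fromGS4 (ax p)         = ax1 p
  fromGS4 (cut d e)      = cut (fromGS4 d) (fromGS4 e)
  fromGS4 (weL d)        = weL (fromGS4 d)
  fromGS4 (weR d)        = weR (fromGS4 d)
  fromGS4 (∧L d)         = ∧L (fromGS4 d)
  fromGS4 (∧R d e)       = ∧R (fromGS4 d) (fromGS4 e)
  fromGS4 (∨L d e)       = ∨L (fromGS4 d) (fromGS4 e)
  fromGS4 (∨R d)         = ∨R (fromGS4 d)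
  fromGS4 (→L d e)       = →L (fromGS4 d) (fromGS4 e)
  fromGS4 (→R d)         = →R (fromGS4 d)
  fromGS4 (□L d)         = □L (fromGS4 d)
  fromGS4 (◇R d)         = ◇R (fromGS4 d)
  fromGS4 (¬L d)         = ¬L-admissible (fromGS4 d)
  fromGS4 (¬R d)         = ¬R-admissible (fromGS4 d)
  fromGS4 (□Rk {Γ} {Δ} d) = □Rₖ Γ Δ (fromGS4 d)
  fromGS4 (◇Lk {Γ} {Δ} d) = ◇Lₖ Γ Δ (fromGS4 d)

module GS4-structural = Structural GS4⊢_⟹_ set-eq cut weL weR ∨L ∨R

module GS4-simulates-TS4 where
  open GS4-structural

  identity : ∀ α → GS4⊢ α ∷ [] ⟹ α ∷ []
  identity (var p) = ax p
  identity (a ∧ b) = ∧L (∧R {Δ = []} (weaken∈ (identity a) ∈₀ ∈₀) (weaken∈ (identity b) ∈₁ ∈₀))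
  identity (a ∨ b) = ∨R {Δ = []} (∨L (weaken∈ (identity a) ∈₀ ∈₀) (weaken∈ (identity b) ∈₀ ∈₁))
  identity (a ⇒ b) = →R {Δ = []}
    (swapˡ (→L {Γ = a ∷ []} {Δ = b ∷ []} (weaken∈ (identity a) ∈₀ ∈₁) (weaken∈ (identity b) ∈₀ ∈₀)))
  identity (¬' a)  = ¬R {Γ = ¬' a ∷ []} {Δ = []} (swapˡ (¬L {Γ = a ∷ []} {Δ = []} (identity a)))
  identity (□ a)   = □Rk {Γ = a ∷ []} {Δ = []} (□L (identity a))
  identity (◇ a)   = ◇Lk {Γ = []} {Δ = a ∷ []} (◇R {Δ = []} (identity a))

  noncontradiction : ∀ α → GS4⊢ ¬' α ∷ α ∷ [] ⟹ []
  noncontradiction α = ¬L {Γ = α ∷ []} {Δ = []} (identity α)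

  excluded-middle : ∀ α → GS4⊢ [] ⟹ ¬' α ∷ α ∷ []
  excluded-middle α = swapʳ (¬R {Γ = []} {Δ = α ∷ []} (identity α))

  open WithIdentity identity
  open Negation noncontradiction excluded-middle

  twist-core : ∀ Γ₂ Δ₂ {Γ Δ} → (GS4⊢ ¬◇s Γ₂ ++ Γ ⟹ ¬□s Δ₂ ++ Δ) ⇔ (GS4⊢ □s Δ₂ ++ Γ ⟹ ◇s Γ₂ ++ Δ)
  twist-core Γ₂ Δ₂ = ⇔.trans (transfer (λ a → ¬' (◇ a)) ◇ ¬-flipˡ Γ₂)
    (⇔.trans (exchange⇔ ↭-refl (↭.shifts (◇s Γ₂) (¬□s Δ₂))) (⇔.sym (transfer □ (λ a → ¬' (□ a)) ¬-flipʳ Δ₂)))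

  □Rₖ² : ∀ Γ Γ′ Δ Δ′ {α} → GS4⊢ □s Γ ++ □s Γ′ ⟹ ◇s Δ ++ ◇s Δ′ ++ α ∷ []
       → GS4⊢ □s Γ ++ □s Γ′ ⟹ ◇s Δ ++ ◇s Δ′ ++ □ α ∷ []
  □Rₖ² Γ Γ′ Δ Δ′ {α}
    rewrite ◇s-++ Δ Δ′ (α ∷ []) | ◇s-++ Δ Δ′ (□ α ∷ []) | sym (map-++ □ Γ Γ′) = □Rk

  ¬□Lₖ² : ∀ Γ Γ′ Δ Δ′ {α} → GS4⊢ □s Γ ++ □s Γ′ ⟹ ◇s Δ ++ ◇s Δ′ ++ α ∷ []
        → GS4⊢ ¬' (□ α) ∷ □s Γ ++ □s Γ′ ⟹ ◇s Δ ++ ◇s Δ′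
  ¬□Lₖ² Γ Γ′ Δ Δ′ {α}
    rewrite ◇s-++ Δ Δ′ (α ∷ []) | sym (map-++ ◇ Δ Δ′) | sym (map-++ □ Γ Γ′) = ¬L ∘ □Rk

  ◇Lₖ² : ∀ Γ Γ′ Δ Δ′ {α} → GS4⊢ α ∷ □s Γ ++ □s Γ′ ⟹ ◇s Δ ++ ◇s Δ′
       → GS4⊢ ◇ α ∷ □s Γ ++ □s Γ′ ⟹ ◇s Δ ++ ◇s Δ′
  ◇Lₖ² Γ Γ′ Δ Δ′
    rewrite sym (map-++ ◇ Δ Δ′) | sym (map-++ □ Γ Γ′) = ◇Lk

  ¬◇Rₖ² : ∀ Γ Γ′ Δ Δ′ {α} → GS4⊢ α ∷ □s Γ ++ □s Γ′ ⟹ ◇s Δ ++ ◇s Δ′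
        → GS4⊢ □s Γ ++ □s Γ′ ⟹ ◇s Δ ++ ◇s Δ′ ++ ¬' (◇ α) ∷ []
  ¬◇Rₖ² Γ Γ′ Δ Δ′ {α}
    rewrite ◇s-++ Δ Δ′ (¬' (◇ α) ∷ []) | sym (map-++ ◇ Δ Δ′) | sym (map-++ □ Γ Γ′) = ¬R ∘ ◇Lk

  module Modal (Γ₁ Γ₂ Δ₁ Δ₂ : Ctx) where

    twist : ∀ X Y → (GS4⊢ X ++ □s Γ₁ ++ ¬◇s Γ₂ ⟹ ◇s Δ₁ ++ ¬□s Δ₂ ++ Y)
                  ⇔ (GS4⊢ X ++ □s Γ₁ ++ □s Δ₂ ⟹ ◇s Δ₁ ++ ◇s Γ₂ ++ Y)
    twist X Y = ⇔.trans (exchange⇔ (++-rotate X (□s Γ₁) (¬◇s Γ₂)) (↭.shifts (◇s Δ₁) (¬□s Δ₂)))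
      (⇔.trans (twist-core Γ₂ Δ₂) (exchange⇔ (↭-sym (++-rotate X (□s Γ₁) (□s Δ₂))) (↭.shifts (◇s Γ₂) (◇s Δ₁))))

    twist₀ : ∀ X → (GS4⊢ X ++ □s Γ₁ ++ ¬◇s Γ₂ ⟹ ◇s Δ₁ ++ ¬□s Δ₂)
                 ⇔ (GS4⊢ X ++ □s Γ₁ ++ □s Δ₂ ⟹ ◇s Δ₁ ++ ◇s Γ₂)
    twist₀ X = ⇔.trans (exchange⇔ (++-rotate X (□s Γ₁) (¬◇s Γ₂)) (↭.++-comm (◇s Δ₁) (¬□s Δ₂)))
      (⇔.trans (twist-core Γ₂ Δ₂) (exchange⇔ (↭-sym (++-rotate X (□s Γ₁) (□s Δ₂))) (↭.++-comm (◇s Γ₂) (◇s Δ₁))))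

    □Rᵀ : ∀ {α} → GS4⊢ □s Γ₁ ++ □s Δ₂ ⟹ ◇s Δ₁ ++ ◇s Γ₂ ++ α ∷ []
        → GS4⊢ □s Γ₁ ++ ¬◇s Γ₂ ⟹ ◇s Δ₁ ++ ¬□s Δ₂ ++ □ α ∷ []
    □Rᵀ {α} = from (twist [] (□ α ∷ [])) ∘ □Rₖ² Γ₁ Δ₂ Δ₁ Γ₂

    ◇Lᵀ : ∀ {α} → GS4⊢ α ∷ □s Γ₁ ++ □s Δ₂ ⟹ ◇s Δ₁ ++ ◇s Γ₂
        → GS4⊢ ◇ α ∷ □s Γ₁ ++ ¬◇s Γ₂ ⟹ ◇s Δ₁ ++ ¬□s Δ₂
    ◇Lᵀ {α} = from (twist₀ (◇ α ∷ [])) ∘ ◇Lₖ² Γ₁ Δ₂ Δ₁ Γ₂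

    ¬□Lᵀ : ∀ {α} → GS4⊢ □s Γ₁ ++ □s Δ₂ ⟹ ◇s Δ₁ ++ ◇s Γ₂ ++ α ∷ []
         → GS4⊢ ¬' (□ α) ∷ □s Γ₁ ++ ¬◇s Γ₂ ⟹ ◇s Δ₁ ++ ¬□s Δ₂
    ¬□Lᵀ {α} = from (twist₀ (¬' (□ α) ∷ [])) ∘ ¬□Lₖ² Γ₁ Δ₂ Δ₁ Γ₂

    ¬◇Rᵀ : ∀ {α} → GS4⊢ α ∷ □s Γ₁ ++ □s Δ₂ ⟹ ◇s Δ₁ ++ ◇s Γ₂
         → GS4⊢ □s Γ₁ ++ ¬◇s Γ₂ ⟹ ◇s Δ₁ ++ ¬□s Δ₂ ++ ¬' (◇ α) ∷ []
    ¬◇Rᵀ {α} = from (twist [] (¬' (◇ α) ∷ [])) ∘ ¬◇Rₖ² Γ₁ Δ₂ Δ₁ Γ₂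

    □Rᵗ : ∀ {α} → GS4⊢ □s Γ₁ ++ ¬◇s Γ₂ ⟹ ◇s Δ₁ ++ ¬□s Δ₂ ++ α ∷ []
        → GS4⊢ □s Γ₁ ++ ¬◇s Γ₂ ⟹ ◇s Δ₁ ++ ¬□s Δ₂ ++ □ α ∷ []
    □Rᵗ {α} = □Rᵀ ∘ to (twist [] (α ∷ []))

    ◇Lᵗ : ∀ {α} → GS4⊢ α ∷ □s Γ₁ ++ ¬◇s Γ₂ ⟹ ◇s Δ₁ ++ ¬□s Δ₂
        → GS4⊢ ◇ α ∷ □s Γ₁ ++ ¬◇s Γ₂ ⟹ ◇s Δ₁ ++ ¬□s Δ₂
    ◇Lᵗ {α} = ◇Lᵀ ∘ to (twist₀ (α ∷ []))

    ¬□Lᵗ : ∀ {α} → GS4⊢ □s Γ₁ ++ ¬◇s Γ₂ ⟹ ◇s Δ₁ ++ ¬□s Δ₂ ++ α ∷ []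
         → GS4⊢ ¬' (□ α) ∷ □s Γ₁ ++ ¬◇s Γ₂ ⟹ ◇s Δ₁ ++ ¬□s Δ₂
    ¬□Lᵗ {α} = ¬□Lᵀ ∘ to (twist [] (α ∷ []))

    ¬◇Rᵗ : ∀ {α} → GS4⊢ α ∷ □s Γ₁ ++ ¬◇s Γ₂ ⟹ ◇s Δ₁ ++ ¬□s Δ₂
         → GS4⊢ □s Γ₁ ++ ¬◇s Γ₂ ⟹ ◇s Δ₁ ++ ¬□s Δ₂ ++ ¬' (◇ α) ∷ []
    ¬◇Rᵗ {α} = ¬◇Rᵀ ∘ to (twist₀ (α ∷ []))

  toGS4 : ∀ {L Γ Δ} → TS4⊢_⟹_ {L} Γ Δ → GS4⊢ Γ ⟹ Δ
  toGS4 (set-eq p q d) = set-eq p q (toGS4 d)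
  toGS4 (ax1 p)        = ax p
  toGS4 (ax2 p)        = identity (¬' (var p))
  toGS4 (ax3 p)        = noncontradiction (var p)
  toGS4 (ax4 p)        = excluded-middle (var p)
  toGS4 (cut d e)      = cut (toGS4 d) (toGS4 e)
  toGS4 (weL d)        = weL (toGS4 d)
  toGS4 (weR d)        = weR (toGS4 d)
  toGS4 (∧L d)         = ∧L (toGS4 d)
  toGS4 (∧R d e)       = ∧R (toGS4 d) (toGS4 e)
  toGS4 (∨L d e)       = ∨L (toGS4 d) (toGS4 e)
  toGS4 (∨R d)         = ∨R (toGS4 d)
  toGS4 (→L d e)       = →L (toGS4 d) (toGS4 e)
  toGS4 (→R d)         = →R (toGS4 d)
  toGS4 (□L d)         = □L (toGS4 d)
  toGS4 (◇R d)         = ◇R (toGS4 d)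
  toGS4 (¬¬L d)        = ¬L (¬R (toGS4 d))
  toGS4 (¬¬R d)        = ¬R (¬L (toGS4 d))
  toGS4 (¬∧L d e)      = ¬L (∧R (toGS4 d) (toGS4 e))
  toGS4 (¬∧R d)        = ¬R (∧L (toGS4 d))
  toGS4 (¬∨L d)        = ¬L (∨R (toGS4 d))
  toGS4 (¬∨R d e)      = ¬R (∨L (toGS4 d) (toGS4 e))
  toGS4 (¬→L d)        = ¬L (→R (toGS4 d))
  toGS4 (¬→R d e)      = ¬R (→L (toGS4 d) (toGS4 e))
  toGS4 (¬□R d)        = ¬R (□L (toGS4 d))
  toGS4 (¬◇L d)        = ¬L (◇R (toGS4 d))
  toGS4 (□RT  {Γ₁} {Γ₂} {Δ₁} {Δ₂} d) = Modal.□Rᵀ Γ₁ Γ₂ Δ₁ Δ₂ (toGS4 d)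
  toGS4 (◇LT  {Γ₁} {Γ₂} {Δ₁} {Δ₂} d) = Modal.◇Lᵀ Γ₁ Γ₂ Δ₁ Δ₂ (toGS4 d)
  toGS4 (¬□LT {Γ₁} {Γ₂} {Δ₁} {Δ₂} d) = Modal.¬□Lᵀ Γ₁ Γ₂ Δ₁ Δ₂ (toGS4 d)
  toGS4 (¬◇RT {Γ₁} {Γ₂} {Δ₁} {Δ₂} d) = Modal.¬◇Rᵀ Γ₁ Γ₂ Δ₁ Δ₂ (toGS4 d)
  toGS4 (□R   {Γ₁} {Γ₂} {Δ₁} {Δ₂} d) = Modal.□Rᵗ Γ₁ Γ₂ Δ₁ Δ₂ (toGS4 d)
  toGS4 (◇L   {Γ₁} {Γ₂} {Δ₁} {Δ₂} d) = Modal.◇Lᵗ Γ₁ Γ₂ Δ₁ Δ₂ (toGS4 d)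
  toGS4 (¬□Lt {Γ₁} {Γ₂} {Δ₁} {Δ₂} d) = Modal.¬□Lᵗ Γ₁ Γ₂ Δ₁ Δ₂ (toGS4 d)
  toGS4 (¬◇Rt {Γ₁} {Γ₂} {Δ₁} {Δ₂} d) = Modal.¬◇Rᵗ Γ₁ Γ₂ Δ₁ Δ₂ (toGS4 d)

theorem3p3 : (L : Variant) (Γ Δ : Ctx) → (TS4⊢_⟹_ {L} Γ Δ) ⇔ (GS4⊢ Γ ⟹ Δ)
theorem3p3 L Γ Δ = mk⇔ GS4-simulates-TS4.toGS4 TS4-simulates-GS4.fromGS4
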